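{- Let $\mathcal{C}$ and $\mathcal{D}$ be gs-monoidal categories and $F:\mathcal{C}\to\mathcal{D}$ a lax symmetric monoidal functor which is either affine or relevant. Then $F$ is domain preserving.
   Context: Composition is diagrammatic ($f;g$ means first $f$, then $g$); the right unitor is $\rho_X:X\to X\otimes I$. A gs-monoidal category is a symmetric monoidal category with, for each object $X$, a discharger $!_X:X\to I$ and duplicator $\nabla_X:X\to X\otimes X$, compatible with the monoidal structure, with $\nabla_X$ coassociative, cocommutative, and $(X,\nabla_X,!_X)$ a comonoid. $F$ has structure arrows $\psi_{X,Y}:F(X)\otimes F(Y)\to F(X\otimes Y)$, $\psi_0:I\to F(I)$. $F$ is affine if $F(!_X)=!_{F(X)};\psi_0$ for all $X$; relevant if $F(\nabla_X)=\nabla_{F(X)};\psi_{X,X}$ for all $X$; domain preserving if $\nabla_{F(X)};\psi_{X,X};F(\mathrm{id}_X\otimes !_X)=F(\rho_X)$ for all $X$. -}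

module Defs where

-- Composition is DIAGRAMMATIC: f ⨾ g means "first f, then g".

open import Level using (Level; _⊔_) renaming (suc to lsuc)
open import Relation.Binary using (Rel; IsEquivalence)
open import Data.Sum using (_⊎_)

record Category (o ℓ e : Level) : Set (lsuc (o ⊔ ℓ ⊔ e)) where
  infixr 9 _⨾_
  infix  4 _≈_
  infixr 0 _⇒_
  field
    Obj  : Set o
    _⇒_  : Obj → Obj → Set ℓ
    _≈_  : ∀ {A B} → Rel (A ⇒ B) e
    id   : ∀ {A} → A ⇒ A
    _⨾_  : ∀ {A B C} → A ⇒ B → B ⇒ C → A ⇒ C
    assoc     : ∀ {A B C D} {f : A ⇒ B} {g : B ⇒ C} {h : C ⇒ D} →
                (f ⨾ g) ⨾ h ≈ f ⨾ (g ⨾ h)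
    identityˡ : ∀ {A B} {f : A ⇒ B} → id ⨾ f ≈ f
    identityʳ : ∀ {A B} {f : A ⇒ B} → f ⨾ id ≈ f
    equiv     : ∀ {A B} → IsEquivalence (_≈_ {A} {B})
    ⨾-resp-≈  : ∀ {A B C} {f f′ : A ⇒ B} {g g′ : B ⇒ C} →
                f ≈ f′ → g ≈ g′ → f ⨾ g ≈ f′ ⨾ g′

-- Directions of the structural isomorphisms:
--   α X Y Z : (X ⊗ Y) ⊗ Z ⇒ X ⊗ (Y ⊗ Z)
--   λ X     : X ⇒ I ⊗ X        (left unitor)
--   ρ X     : X ⇒ X ⊗ I        (right unitor, as in the paper)
-- each with an explicit two-sided inverse.
record Monoidal {o ℓ e} (C : Category o ℓ e) : Set (o ⊔ ℓ ⊔ e) where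
  open Category C
  infixr 10 _⊗₀_ _⊗₁_
  field
    _⊗₀_ : Obj → Obj → Obj
    _⊗₁_ : ∀ {A B X Y} → A ⇒ B → X ⇒ Y → (A ⊗₀ X) ⇒ (B ⊗₀ Y)
    I    : Obj
    ⊗-identity : ∀ {A X} → id {A} ⊗₁ id {X} ≈ id
    ⊗-homomorphism : ∀ {A B C X Y Z} {f : A ⇒ B} {g : B ⇒ C} {h : X ⇒ Y} {k : Y ⇒ Z} →
                     (f ⨾ g) ⊗₁ (h ⨾ k) ≈ (f ⊗₁ h) ⨾ (g ⊗₁ k)
    ⊗-resp-≈ : ∀ {A B X Y} {f f′ : A ⇒ B} {g g′ : X ⇒ Y} →
               f ≈ f′ → g ≈ g′ → f ⊗₁ g ≈ f′ ⊗₁ g′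
    α  : ∀ X Y Z → ((X ⊗₀ Y) ⊗₀ Z) ⇒ (X ⊗₀ (Y ⊗₀ Z))
    α⁻¹ : ∀ X Y Z → (X ⊗₀ (Y ⊗₀ Z)) ⇒ ((X ⊗₀ Y) ⊗₀ Z)
    λ′  : ∀ X → X ⇒ (I ⊗₀ X)
    λ⁻¹ : ∀ X → (I ⊗₀ X) ⇒ X
    ρ   : ∀ X → X ⇒ (X ⊗₀ I)
    ρ⁻¹ : ∀ X → (X ⊗₀ I) ⇒ X
    α-isoˡ : ∀ {X Y Z} → α X Y Z ⨾ α⁻¹ X Y Z ≈ id
    α-isoʳ : ∀ {X Y Z} → α⁻¹ X Y Z ⨾ α X Y Z ≈ id
    λ-isoˡ : ∀ {X} → λ′ X ⨾ λ⁻¹ X ≈ id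
    λ-isoʳ : ∀ {X} → λ⁻¹ X ⨾ λ′ X ≈ id
    ρ-isoˡ : ∀ {X} → ρ X ⨾ ρ⁻¹ X ≈ id
    ρ-isoʳ : ∀ {X} → ρ⁻¹ X ⨾ ρ X ≈ id
    α-natural : ∀ {A B C X Y Z} {f : A ⇒ X} {g : B ⇒ Y} {h : C ⇒ Z} →
                ((f ⊗₁ g) ⊗₁ h) ⨾ α X Y Z ≈ α A B C ⨾ (f ⊗₁ (g ⊗₁ h))
    λ-natural : ∀ {A B} {f : A ⇒ B} → f ⨾ λ′ B ≈ λ′ A ⨾ (id ⊗₁ f)
    ρ-natural : ∀ {A B} {f : A ⇒ B} → f ⨾ ρ B ≈ ρ A ⨾ (f ⊗₁ id)
    pentagon : ∀ {W X Y Z} →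
               (α W X Y ⊗₁ id {Z}) ⨾ α W (X ⊗₀ Y) Z ⨾ (id {W} ⊗₁ α X Y Z)
               ≈ α (W ⊗₀ X) Y Z ⨾ α W X (Y ⊗₀ Z)
    triangle : ∀ {X Y} →
               (ρ X ⊗₁ id {Y}) ⨾ α X I Y ≈ id {X} ⊗₁ λ′ Y

record Symmetric {o ℓ e} {C : Category o ℓ e} (M : Monoidal C) : Set (o ⊔ ℓ ⊔ e) where
  open Category C
  open Monoidal M
  field
    σ : ∀ X Y → (X ⊗₀ Y) ⇒ (Y ⊗₀ X)
    σ-natural : ∀ {A B X Y} {f : A ⇒ X} {g : B ⇒ Y} →
                (f ⊗₁ g) ⨾ σ X Y ≈ σ A B ⨾ (g ⊗₁ f)
    σ-involutive : ∀ {X Y} → σ X Y ⨾ σ Y X ≈ id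
    hexagon : ∀ {X Y Z} →
              α X Y Z ⨾ σ X (Y ⊗₀ Z) ⨾ α Y Z X
              ≈ (σ X Y ⊗₁ id {Z}) ⨾ α Y X Z ⨾ (id {Y} ⊗₁ σ X Z)

-- gs-monoidal category: symmetric monoidal category with a discharger !
-- and a duplicator ∇ on each object (NOT required to be natural),
-- compatible with the monoidal structure, making each object a
-- cocommutative comonoid.
record GSMonoidalCategory (o ℓ e : Level) : Set (lsuc (o ⊔ ℓ ⊔ e)) where
  field
    category  : Category o ℓ e
    monoidal  : Monoidal category
    symmetric : Symmetric monoidal
  open Category category
  open Monoidal monoidal
  open Symmetric symmetric
  interchange : ∀ X Y → ((X ⊗₀ X) ⊗₀ (Y ⊗₀ Y)) ⇒ ((X ⊗₀ Y) ⊗₀ (X ⊗₀ Y))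
  interchange X Y =
    α X X (Y ⊗₀ Y) ⨾ (id ⊗₁ α⁻¹ X Y Y) ⨾ (id ⊗₁ (σ X Y ⊗₁ id))
      ⨾ (id ⊗₁ α Y X Y) ⨾ α⁻¹ X Y (X ⊗₀ Y)
  field
    !  : ∀ X → X ⇒ I
    ∇  : ∀ X → X ⇒ (X ⊗₀ X)
    !-unit   : ! I ≈ id
    ∇-unit   : ∇ I ≈ ρ I
    !-tensor : ∀ {X Y} → ! (X ⊗₀ Y) ≈ (! X ⊗₁ ! Y) ⨾ λ⁻¹ I
    ∇-tensor : ∀ {X Y} → ∇ (X ⊗₀ Y) ≈ (∇ X ⊗₁ ∇ Y) ⨾ interchange X Y
    ∇-coassoc : ∀ {X} → ∇ X ⨾ (id ⊗₁ ∇ X) ≈ ∇ X ⨾ (∇ X ⊗₁ id) ⨾ α X X X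
    ∇-cocomm  : ∀ {X} → ∇ X ⨾ σ X X ≈ ∇ X
    counitˡ   : ∀ {X} → ∇ X ⨾ (! X ⊗₁ id) ≈ λ′ X
    counitʳ   : ∀ {X} → ∇ X ⨾ (id ⊗₁ ! X) ≈ ρ X

-- Lax symmetric monoidal functor between gs-monoidal categories
-- (only the underlying symmetric monoidal structure is involved).
record LaxSymmetricMonoidalFunctor {o ℓ e o′ ℓ′ e′}
         (𝒞 : GSMonoidalCategory o ℓ e) (𝒟 : GSMonoidalCategory o′ ℓ′ e′)
         : Set (o ⊔ ℓ ⊔ e ⊔ o′ ⊔ ℓ′ ⊔ e′) where
  private
    module C = GSMonoidalCategory 𝒞
    module D = GSMonoidalCategory 𝒟
    module CC = Category C.category
    module DC = Category D.category
    module CM = Monoidal C.monoidal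
    module DM = Monoidal D.monoidal
    module CS = Symmetric C.symmetric
    module DS = Symmetric D.symmetric
  open DC using (_≈_; _⨾_)
  field
    F₀ : CC.Obj → DC.Obj
    F₁ : ∀ {A B} → A CC.⇒ B → F₀ A DC.⇒ F₀ B
    identity     : ∀ {A} → F₁ (CC.id {A}) ≈ DC.id
    homomorphism : ∀ {A B C} {f : A CC.⇒ B} {g : B CC.⇒ C} →
                   F₁ (f CC.⨾ g) ≈ F₁ f ⨾ F₁ g
    F-resp-≈     : ∀ {A B} {f g : A CC.⇒ B} → f CC.≈ g → F₁ f ≈ F₁ g
    ψ  : ∀ X Y → (F₀ X DM.⊗₀ F₀ Y) DC.⇒ F₀ (X CM.⊗₀ Y)
    ψ₀ : DM.I DC.⇒ F₀ CM.I
    ψ-natural : ∀ {A B X Y} {f : A CC.⇒ X} {g : B CC.⇒ Y} →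
                (F₁ f DM.⊗₁ F₁ g) ⨾ ψ X Y ≈ ψ A B ⨾ F₁ (f CM.⊗₁ g)
    associativity : ∀ {X Y Z} →
                    (ψ X Y DM.⊗₁ DC.id) ⨾ ψ (X CM.⊗₀ Y) Z ⨾ F₁ (CM.α X Y Z)
                    ≈ DM.α (F₀ X) (F₀ Y) (F₀ Z) ⨾ (DC.id DM.⊗₁ ψ Y Z) ⨾ ψ X (Y CM.⊗₀ Z)
    unitaryˡ : ∀ {X} → DM.λ′ (F₀ X) ⨾ (ψ₀ DM.⊗₁ DC.id) ⨾ ψ CM.I X ≈ F₁ (CM.λ′ X)
    unitaryʳ : ∀ {X} → DM.ρ (F₀ X) ⨾ (DC.id DM.⊗₁ ψ₀) ⨾ ψ X CM.I ≈ F₁ (CM.ρ X)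
    braiding-compat : ∀ {X Y} →
                      DS.σ (F₀ X) (F₀ Y) ⨾ ψ Y X ≈ ψ X Y ⨾ F₁ (CS.σ X Y)

module _ {o ℓ e o′ ℓ′ e′}
         {𝒞 : GSMonoidalCategory o ℓ e} {𝒟 : GSMonoidalCategory o′ ℓ′ e′}
         (F : LaxSymmetricMonoidalFunctor 𝒞 𝒟) where
  private
    module C = GSMonoidalCategory 𝒞
    module D = GSMonoidalCategory 𝒟
    module CC = Category C.category
    module DC = Category D.category
    module CM = Monoidal C.monoidal
    module DM = Monoidal D.monoidal
  open LaxSymmetricMonoidalFunctor F
  open DC using (_≈_; _⨾_)

  Affine : Set (o ⊔ e′)
  Affine = ∀ X → F₁ (C.! X) ≈ D.! (F₀ X) ⨾ ψ₀

  Relevant : Set (o ⊔ e′)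
  Relevant = ∀ X → F₁ (C.∇ X) ≈ D.∇ (F₀ X) ⨾ ψ X X

  DomainPreserving : Set (o ⊔ e′)
  DomainPreserving = ∀ X → D.∇ (F₀ X) ⨾ ψ X X ⨾ F₁ (CC.id CM.⊗₁ C.! X) ≈ F₁ (CM.ρ X)

{-# OPTIONS --safe #-}
module Submission where

open import Defs
open import Data.Sum using (_⊎_; [_,_])
open import Relation.Binary using (Setoid)
import Relation.Binary.Reasoning.Setoid as SetoidReasoning

-- Relevance makes the domain-preservation equation the image under F of the
-- counit law, while affineness pushes ! through ψ by naturality, turning it
-- into the counit law of F X followed by the right unitality of ψ.

module HomReasoning {o ℓ e} (C : Category o ℓ e) where
  open Category C

  hom-setoid : Obj → Obj → Setoid ℓ e
  hom-setoid A B = record { Carrier = A ⇒ B ; _≈_ = _≈_ ; isEquivalence = equiv }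

  open module HomEquivalence {A B : Obj} = Setoid (hom-setoid A B) public
    using (refl; sym; trans)
  open module Reasoning {A B : Obj} = SetoidReasoning (hom-setoid A B) public

module _ {o ℓ e o′ ℓ′ e′}
         {𝒞 : GSMonoidalCategory o ℓ e} {𝒟 : GSMonoidalCategory o′ ℓ′ e′}
         (F : LaxSymmetricMonoidalFunctor 𝒞 𝒟) where
  private
    module C = GSMonoidalCategory 𝒞
    module D = GSMonoidalCategory 𝒟
    module CC = Category C.category
    module CM = Monoidal C.monoidal
    module DM = Monoidal D.monoidal
  open Category D.category
  open HomReasoning D.category
  open LaxSymmetricMonoidalFunctor F

  relevant⇒domainPreserving : Relevant F → DomainPreserving F
  relevant⇒domainPreserving relevant X = begin
    D.∇ (F₀ X) ⨾ ψ X X ⨾ F₁ (CC.id CM.⊗₁ C.! X)   ≈⟨ assoc ⟨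
    (D.∇ (F₀ X) ⨾ ψ X X) ⨾ F₁ (CC.id CM.⊗₁ C.! X) ≈⟨ ⨾-resp-≈ (relevant X) refl ⟨
    F₁ (C.∇ X) ⨾ F₁ (CC.id CM.⊗₁ C.! X)           ≈⟨ homomorphism ⟨
    F₁ (C.∇ X CC.⨾ (CC.id CM.⊗₁ C.! X))           ≈⟨ F-resp-≈ C.counitʳ ⟩
    F₁ (CM.ρ X)                                    ∎

  affine⇒domainPreserving : Affine F → DomainPreserving F
  affine⇒domainPreserving affine X = begin
    D.∇ (F₀ X) ⨾ ψ X X ⨾ F₁ (CC.id CM.⊗₁ C.! X)           ≈⟨ ⨾-resp-≈ refl ψ-natural ⟨
    D.∇ (F₀ X) ⨾ (F₁ CC.id DM.⊗₁ F₁ (C.! X)) ⨾ ψ X CM.I    ≈⟨ assoc ⟨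
    (D.∇ (F₀ X) ⨾ (F₁ CC.id DM.⊗₁ F₁ (C.! X))) ⨾ ψ X CM.I  ≈⟨ ⨾-resp-≈ counitʳ-image refl ⟩
    (DM.ρ (F₀ X) ⨾ (id DM.⊗₁ ψ₀)) ⨾ ψ X CM.I               ≈⟨ assoc ⟩
    DM.ρ (F₀ X) ⨾ (id DM.⊗₁ ψ₀) ⨾ ψ X CM.I                 ≈⟨ unitaryʳ ⟩
    F₁ (CM.ρ X)                                            ∎
    where
    F-id⊗F-!-split : F₁ CC.id DM.⊗₁ F₁ (C.! X) ≈ (id DM.⊗₁ D.! (F₀ X)) ⨾ (id DM.⊗₁ ψ₀)
    F-id⊗F-!-split = begin
      F₁ CC.id DM.⊗₁ F₁ (C.! X)              ≈⟨ DM.⊗-resp-≈ (trans identity (sym identityˡ)) (affine X) ⟩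
      (id ⨾ id) DM.⊗₁ (D.! (F₀ X) ⨾ ψ₀)      ≈⟨ DM.⊗-homomorphism ⟩
      (id DM.⊗₁ D.! (F₀ X)) ⨾ (id DM.⊗₁ ψ₀)  ∎

    counitʳ-image : D.∇ (F₀ X) ⨾ (F₁ CC.id DM.⊗₁ F₁ (C.! X)) ≈ DM.ρ (F₀ X) ⨾ (id DM.⊗₁ ψ₀)
    counitʳ-image = begin
      D.∇ (F₀ X) ⨾ (F₁ CC.id DM.⊗₁ F₁ (C.! X))                   ≈⟨ ⨾-resp-≈ refl F-id⊗F-!-split ⟩
      D.∇ (F₀ X) ⨾ (id DM.⊗₁ D.! (F₀ X)) ⨾ (id DM.⊗₁ ψ₀)         ≈⟨ assoc ⟨
      (D.∇ (F₀ X) ⨾ (id DM.⊗₁ D.! (F₀ X))) ⨾ (id DM.⊗₁ ψ₀)       ≈⟨ ⨾-resp-≈ D.counitʳ refl ⟩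
      DM.ρ (F₀ X) ⨾ (id DM.⊗₁ ψ₀)                                ∎

proposition4p6 : ∀ {o ℓ e o′ ℓ′ e′}
    (𝒞 : GSMonoidalCategory o ℓ e) (𝒟 : GSMonoidalCategory o′ ℓ′ e′)
    (F : LaxSymmetricMonoidalFunctor 𝒞 𝒟) →
    Affine F ⊎ Relevant F → DomainPreserving F
proposition4p6 𝒞 𝒟 F = [ affine⇒domainPreserving F , relevant⇒domainPreserving F ]
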